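{- Let $k\ge2$. (1) If $m<n$ are natural numbers in $k$-normal form, then $o_k(m)<o_k(n)$. (2) If $\alpha<\beta$ are terms in $OT_0$, then $o_k(\alpha)<o_k(\beta)$.
   Context: Ordinal terms. Let $T$ be the set of formal terms generated by: $0,1\in T$; if $\beta\in T$ then $\psi_0\beta,\psi_1\beta,\psi_2\beta\in T$ (these and $1$ are the principal terms); if $\alpha_0\ge\dots\ge\alpha_n$ ($n\ge1$) are principal terms then $\alpha_0+\dots+\alpha_n\in T$. The linear order $<$ on $T$ is generated by: $0<\alpha$ for $\alpha\ne0$; $1<\psi_i\beta$; $\psi_i\alpha<\psi_i\beta$ if $\alpha<\beta$; $\psi_i\alpha<\psi_j\beta$ if $i<j$; sums (a principal term counting as a sum of length one) are compared lexicographically. Abbreviations: $\omega:=\psi_00$, $\Omega:=\psi_10$, $\Omega_2:=\psi_20$; a natural number $n$ is identified with $1+\dots+1$; $+$ between terms is term addition and $\alpha\cdot x$ is the $x$-fold sum. For a set $A$ of terms, $A<\beta$ means every element of $A$ is $<\beta$. Sets $G_0,G_1$: $G_1\alpha=\emptyset$ if $\alpha<\Omega$; $G_1\psi_2\beta=G_1\beta$; $G_1$ of a sum is the union over summands; $G_1\psi_1\beta=\{\beta\}\cup G_1\beta$; $G_1\psi_0\beta=\emptyset$. $G_00=G_01=\emptyset$; $G_0\psi_2\beta=G_0\beta$; $G_0$ of a sum is the union; $G_0\psi_1\beta=G_0\beta$; $G_0\psi_0\beta=\{\beta\}\cup G_0\beta$. $OT\subseteq T$: $0,1\in OT$; $\psi_2\beta\in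 OT$ if $\beta\in OT$; a sum is in $OT$ if all summands are; $\psi_1\beta\in OT$ if $\beta\in OT$ and $G_1\beta<\beta$; $\psi_0\beta\in OT$ if $\beta\in OT$, $G_0\beta<\beta$, $\beta<\Omega_2$. $\varepsilon_{\Omega+1}$ denotes $\psi_1\Omega_2$, and $OT_0:=\{\alpha\in OT:\alpha<\varepsilon_{\Omega+1},\ G_0\alpha<\varepsilon_{\Omega+1}\}$. Fundamental sequences: $tp(0)=0$; $tp(1)=1$, $1[0]=0$; for $\Omega_0:=\omega,\Omega_1:=\Omega,\Omega_2$: $tp(\Omega_i)=\Omega_i$, $\Omega_i[x]=x$; for a sum $\alpha_0+\dots+\alpha_n$ ($n\ge1$): $tp=tp(\alpha_n)$, $(\alpha_0+\dots+\alpha_n)[x]=\alpha_0+\dots+\alpha_{n-1}+\alpha_n[x]$; if $tp(\alpha)=1$: $tp(\psi_i\alpha)=\omega$, $(\psi_i\alpha)[x]=\psi_i(\alpha[0])\cdot x$; if $tp(\alpha)\notin\{0,1\}$ and ($i=2$ or $tp(\alpha)<\Omega_{i+1}$): $tp(\psi_i\alpha)=tp(\alpha)$, $(\psi_i\alpha)[x]=\psi_i(\alpha[x])$; if $tp(\alpha)=\Omega$: $tp(\psi_0\alpha)=\omega$, $(\psi_0\alpha)[x]=\psi_0(\alpha[z_x])$, $z_0=0$, $z_{x+1}=\psi_0(\alpha[z_x])$; if $tp(\alpha)=\Omega_2$: $tp(\psi_1\alpha)=\omega$, $(\psi_1\alpha)[x]=\psi_1(\alpha[z_x])$, $z_0=0$,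 $z_{x+1}=\psi_1(\alpha[z_x])$. Conventions: $0[x]=0$, $(\alpha+1)[x]=\alpha$, if $tp(\alpha)\in\{0,1\}$ then $\alpha[m]=\alpha[0]$. Hardy hierarchy. For $k\ge1$ and $\alpha\in OT_0$, $\alpha<\Omega$: $H_0(k)=k$; $H_{\alpha+1}(k)=H_\alpha(k)\cdot k$; if $tp(\lambda)=\omega$, $H_\lambda(k)=H_{\lambda\{k\}}(k)$ with $\lambda\{0\}=\lambda[0]$, $\lambda\{b+1\}=\lambda[H_{\lambda\{b\}}(k)]$. $k$-normal forms ($k\ge2$): each $m<k$ is its own $k$-normal form; for $m\ge k$ let $\alpha$ be the largest $\alpha\in OT_0$, $\alpha<\Omega$, with $H_\alpha(k)\le m$, and write $m=_kH_\alpha(k)\cdot p+q$ with $1\le p<k$, $q<H_\alpha(k)$; hereditarily, $q$ is in $k$-normal form and each term of $OT_0$ is written $\alpha_0+\dots+\alpha_n+l$ with principal $\alpha_i=\psi_j\beta$ and natural number $l$, where $l$ and recursively the $\beta$ are in $k$-normal form. Ordinal assignment ($k\ge2$): $o_k(m)=m$ for $m<k$; $o_k(k)=\omega$; $o_k(m)=\psi_0(o_k(\alpha))\cdot p+o_k(q)$ if $m=_kH_\alpha(k)\cdot p+q$; $o_k(0)=0$; $o_k(\alpha_0+\dots+\alpha_n+l)=o_k(\alpha_0)+\dots+o_k(\alpha_n)+o_k(l)$; $o_k(\psi_0\beta)=\psi_1(o_k(\beta))$; $o_k(\psi_1\beta)=\psi_2(o_k(\beta))$. The order $<$ on values is the order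 of $T$. -}

module Defs where

open import Data.Nat using (ℕ; zero; suc; _*_; _+_; _<_; _≤_)
open import Data.Fin using (Fin; toℕ)
open import Data.Bool using (Bool; true; false; if_then_else_; _∧_; _∨_; not; T)
open import Data.List using (List; []; _∷_; _++_; replicate)
open import Data.List.Relation.Unary.All using (All)
open import Data.Product using (Σ; _×_)
open import Relation.Binary.PropositionalEquality using (_≡_)
open import Relation.Nullary using (¬_)

-- A term of T is represented as the list of its summands:
--   []        represents 0,
--   [ p ]     represents the principal term p,
--   p₀ ∷ … ∷ pₙ (n ≥ 1) represents the sum p₀ + … + pₙ.
-- The side condition α₀ ≥ … ≥ αₙ of T is checked by `isT` below.

data Prin : Set where
  one : Prin
  ψ   : Fin 3 → List Prin → Prin

Tm : Set
Tm = List Prin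

data Cmp : Set where
  lt eq gt : Cmp

cmpℕ : ℕ → ℕ → Cmp
cmpℕ zero    zero    = eq
cmpℕ zero    (suc _) = lt
cmpℕ (suc _) zero    = gt
cmpℕ (suc m) (suc n) = cmpℕ m n

lexi : Cmp → Cmp → Cmp
lexi lt _ = lt
lexi gt _ = gt
lexi eq c = c

mutual
  cmpP : Prin → Prin → Cmp
  cmpP one     one     = eq
  cmpP one     (ψ _ _) = lt
  cmpP (ψ _ _) one     = gt
  cmpP (ψ i a) (ψ j b) = lexi (cmpℕ (toℕ i) (toℕ j)) (cmpL a b)

  cmpL : Tm → Tm → Cmp
  cmpL []       []       = eq
  cmpL []       (_ ∷ _)  = lt
  cmpL (_ ∷ _)  []       = gt
  cmpL (p ∷ ps) (q ∷ qs) = lexi (cmpP p q) (cmpL ps qs)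

isLt : Cmp → Bool
isLt lt = true
isLt _  = false

isEq : Cmp → Bool
isEq eq = true
isEq _  = false

_<ᵇ_ : Tm → Tm → Bool
α <ᵇ β = isLt (cmpL α β)

_≈ᵇ_ : Tm → Tm → Bool
α ≈ᵇ β = isEq (cmpL α β)

_<ₚᵇ_ : Prin → Prin → Bool
p <ₚᵇ q = isLt (cmpP p q)

infix 4 _<ₒ_ _≤ₒ_
_<ₒ_ : Tm → Tm → Set
α <ₒ β = cmpL α β ≡ lt

_≤ₒ_ : Tm → Tm → Set
α ≤ₒ β = ¬ (β <ₒ α)

ω Ω Ω₂ ε-Ω+1 : Tm
ω  = ψ Fin.zero [] ∷ []
Ω  = ψ (Fin.suc Fin.zero) [] ∷ []
Ω₂ = ψ (Fin.suc (Fin.suc Fin.zero)) [] ∷ []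
ε-Ω+1 = ψ (Fin.suc Fin.zero) Ω₂ ∷ []

nat : ℕ → Tm
nat n = replicate n one

-- term addition (addition of terms in Cantor normal form:
-- summands of α smaller than the first summand of β are absorbed)
keepGe : Prin → Tm → Tm
keepGe b []       = []
keepGe b (a ∷ as) = if a <ₚᵇ b then [] else a ∷ keepGe b as

infixl 6 _⊕_
_⊕_ : Tm → Tm → Tm
α ⊕ []       = α
α ⊕ (b ∷ bs) = keepGe b α ++ (b ∷ bs)

_·_ : Tm → ℕ → Tm
α · zero  = []
α · suc x = (α · x) ⊕ α

toNat : Tm → ℕ
toNat []            = zero
toNat (one ∷ r)     = suc (toNat r)
toNat (ψ _ _ ∷ _)   = zero

decr : Tm → Bool
decr []            = true
decr (p ∷ [])      = true
decr (p ∷ q ∷ r)   = not (p <ₚᵇ q) ∧ decr (q ∷ r)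

allLt : List Tm → Tm → Bool
allLt []       β = true
allLt (a ∷ as) β = (a <ᵇ β) ∧ allLt as β

mutual
  G₀ : Tm → List Tm
  G₀ []       = []
  G₀ (p ∷ ps) = G₀ₚ p ++ G₀ ps

  G₀ₚ : Prin → List Tm
  G₀ₚ one                              = []
  G₀ₚ (ψ Fin.zero β)                   = β ∷ G₀ β
  G₀ₚ (ψ (Fin.suc Fin.zero) β)         = G₀ β
  G₀ₚ (ψ (Fin.suc (Fin.suc Fin.zero)) β) = G₀ β

mutual
  G₁ : Tm → List Tm
  G₁ α = if α <ᵇ Ω then [] else G₁ₛ α

  G₁ₛ : Tm → List Tm
  G₁ₛ []       = []
  G₁ₛ (p ∷ ps) = G₁ₚ p ++ G₁ₛ ps

  G₁ₚ : Prin → List Tm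
  G₁ₚ p = if (p ∷ []) <ᵇ Ω then [] else G₁ₚ' p

  G₁ₚ' : Prin → List Tm
  G₁ₚ' one                                = []
  G₁ₚ' (ψ Fin.zero β)                     = []
  G₁ₚ' (ψ (Fin.suc Fin.zero) β)           = β ∷ G₁ β
  G₁ₚ' (ψ (Fin.suc (Fin.suc Fin.zero)) β) = G₁ β

mutual
  isOT : Tm → Bool
  isOT α = decr α ∧ allOT α

  allOT : Tm → Bool
  allOT []       = true
  allOT (p ∷ ps) = isOTₚ p ∧ allOT ps

  isOTₚ : Prin → Bool
  isOTₚ one = true
  isOTₚ (ψ Fin.zero β) = isOT β ∧ allLt (G₀ β) β ∧ (β <ᵇ Ω₂)
  isOTₚ (ψ (Fin.suc Fin.zero) β) = isOT β ∧ allLt (G₁ β) β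
  isOTₚ (ψ (Fin.suc (Fin.suc Fin.zero)) β) = isOT β

OT : Tm → Set
OT α = T (isOT α)

OT₀ : Tm → Set
OT₀ α = OT α × α <ₒ ε-Ω+1 × All (_<ₒ ε-Ω+1) (G₀ α)

-- Fundamental sequences: tp α and α[x] (written fs α x).
-- Arguments x that the paper takes to be natural numbers are passed as
-- the numeral terms 1+…+1 and read back with toNat.
-- Cases left unspecified by the paper default to 0.

tpψ : Fin 3 → Tm → Tm
tpψ Fin.zero t =
  if t ≈ᵇ [] then [] else
  if t ≈ᵇ (one ∷ []) then ω else
  if t <ᵇ Ω then t else
  if t ≈ᵇ Ω then ω else []
tpψ (Fin.suc Fin.zero) t =
  if t ≈ᵇ [] then [] else
  if t ≈ᵇ (one ∷ []) then ω else
  if t <ᵇ Ω₂ then t else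
  if t ≈ᵇ Ω₂ then ω else []
tpψ (Fin.suc (Fin.suc Fin.zero)) t =
  if t ≈ᵇ [] then [] else
  if t ≈ᵇ (one ∷ []) then ω else t

mutual
  tp : Tm → Tm
  tp []          = []
  tp (p ∷ [])    = tpₚ p
  tp (p ∷ q ∷ r) = tp (q ∷ r)

  tpₚ : Prin → Tm
  tpₚ one            = one ∷ []
  tpₚ (ψ i [])       = ψ i [] ∷ []
  tpₚ (ψ i (b ∷ bs)) = tpψ i (tp (b ∷ bs))

genCase : Fin 3 → Tm → Bool
genCase Fin.zero t = t <ᵇ Ω
genCase (Fin.suc Fin.zero) t = t <ᵇ Ω₂
genCase (Fin.suc (Fin.suc Fin.zero)) t = true

collCase : Fin 3 → Tm → Bool
collCase Fin.zero t = t ≈ᵇ Ω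
collCase (Fin.suc Fin.zero) t = t ≈ᵇ Ω₂
collCase (Fin.suc (Fin.suc Fin.zero)) t = false

mutual
  fs : Tm → Tm → Tm
  fs []          x = []
  fs (p ∷ [])    x = fsₚ p x
  fs (p ∷ q ∷ r) x = (p ∷ []) ⊕ fs (q ∷ r) x

  fsₚ : Prin → Tm → Tm
  fsₚ one            x = []
  fsₚ (ψ i [])       x = x
  fsₚ (ψ i (b ∷ bs)) x = fsψ i (b ∷ bs) x

  fsψ : Fin 3 → Tm → Tm → Tm
  fsψ i β x =
    if tp β ≈ᵇ [] then [] else
    if tp β ≈ᵇ (one ∷ []) then (ψ i (fs β []) ∷ []) · toNat x else
    if genCase i (tp β) then ψ i (fs β x) ∷ [] else
    if collCase i (tp β) then ψ i (fs β (zs i β (toNat x))) ∷ [] else []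

  zs : Fin 3 → Tm → ℕ → Tm
  zs i β zero    = []
  zs i β (suc n) = ψ i (fs β (zs i β n)) ∷ []

-- Hardy hierarchy, as its (functional) graph: Hardy k α v  means H_α(k) = v.
-- Braces k λ b μ  means  λ{b} = μ.

mutual
  data Hardy (k : ℕ) : Tm → ℕ → Set where
    H-zero : Hardy k [] k
    H-suc  : ∀ {α v} → Hardy k α v → Hardy k (α ⊕ (one ∷ [])) (v * k)
    H-lim  : ∀ {λ' μ v} → tp λ' ≡ ω → Braces k λ' k μ → Hardy k μ v →
             Hardy k λ' v

  data Braces (k : ℕ) (λ' : Tm) : ℕ → Tm → Set where
    B-zero : Braces k λ' zero (fs λ' [])
    B-suc  : ∀ {b μ h} → Braces k λ' b μ → Hardy k μ h →
             Braces k λ' (suc b) (fs λ' (nat h))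

record IsNF (k m : ℕ) (α : Tm) (p q : ℕ) : Set where
  field
    α-OT₀    : OT₀ α
    α<Ω      : α <ₒ Ω
    h        : ℕ
    hardy    : Hardy k α h
    h≤m      : h ≤ m
    largest  : ∀ β h' → OT₀ β → β <ₒ Ω → Hardy k β h' → h' ≤ m → β ≤ₒ α
    decomp   : m ≡ h * p + q
    1≤p      : 1 ≤ p
    p<k      : p < k
    q<h      : q < h

-- OkN k m a : o_k(m) = a  for natural numbers m (via k-normal forms);
-- OkT k α a : o_k(α) = a  for terms α = α₀+…+αₙ+l (αᵢ = ψ_j β, l numeral);
-- OkP k p a : o_k(p) = a  for principal p = ψ_j β (j = 0,1).

mutual
  data OkN (k : ℕ) : ℕ → Tm → Set where
    n-small : ∀ {m} → m < k → OkN k m (nat m)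
    n-k     : OkN k k ω
    n-big   : ∀ {m α p q a c} → k < m → IsNF k m α p q →
              OkT k α a → OkN k q c →
              OkN k m (((ψ Fin.zero a ∷ []) · p) ⊕ c)

  data OkT (k : ℕ) : Tm → Tm → Set where
    t-nat  : ∀ {l c} → OkN k l c → OkT k (nat l) c
    t-cons : ∀ {i β rest a c} → OkP k (ψ i β) a → OkT k rest c →
             OkT k (ψ i β ∷ rest) (a ⊕ c)

  data OkP (k : ℕ) : Prin → Tm → Set where
    p-ψ₀ : ∀ {β b} → OkT k β b →
           OkP k (ψ Fin.zero β) (ψ (Fin.suc Fin.zero) b ∷ [])
    p-ψ₁ : ∀ {β b} → OkT k β b →
           OkP k (ψ (Fin.suc Fin.zero) β) (ψ (Fin.suc (Fin.suc Fin.zero)) b ∷ [])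

-- o_k works summand by summand, and images of natural numbers consist of 1s and ψ₀-summands
-- only, so they lie below Ω and hence below the image of every ψ₀- or ψ₁-term.  As long as ⊕
-- never absorbs a summand, images compare lexicographically, and each comparison reduces to
-- comparisons one level down: for terms, of the arguments of the leading summands and then of
-- the tails; for m = H_α(k)·p + q, first of the levels α (terms; the level grows with m), then
-- of p, then of the remainders q.  Nothing is absorbed: the summands of an OT-term decrease, and
-- q < H_α(k) puts the level of q below α, so o_k(q) starts below ψ₀(o_k α).  Since these facts
-- need monotonicity one level down, everything is one induction on the derivations of o_k.

module Submission where

open import Defs
open import Data.Bool using (T; true; false; not; _∧_)
open import Data.Bool.Properties using (T-∧)
open import Data.Empty using (⊥; ⊥-elim)
open import Data.Fin using (Fin; toℕ)
open import Data.Fin.Properties using (toℕ-injective)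
open import Data.List using (List; []; _∷_; _++_; _∷ʳ_; replicate; length)
open import Data.List.Properties
  using (++-identityʳ; ++-conicalʳ; ∷-injectiveˡ; ∷ʳ-injectiveˡ; length-replicate)
open import Data.List.Relation.Unary.All using (All; []; _∷_)
open import Data.List.Relation.Unary.All.Properties using (++⁺; replicate⁺)
open import Data.Nat using (ℕ; zero; suc; _+_; _*_; _≤_; _<_; z≤n; s≤s)
open import Data.Nat.Properties
open import Data.Product using (Σ; _×_; _,_; proj₁; proj₂)
open import Data.Sum using (_⊎_; inj₁; inj₂)
open import Data.Unit using (⊤; tt)
open import Function using (case_of_)
open import Function.Bundles using (Equivalence)
open import Relation.Binary.Definitions using (Tri; tri<; tri≈; tri>)
open import Relation.Binary.PropositionalEquality
open import Relation.Nullary using (¬_)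

pattern ψ₀ β = ψ Fin.zero β
pattern ψ₁ β = ψ (Fin.suc Fin.zero) β
pattern ψ₂ β = ψ (Fin.suc (Fin.suc Fin.zero)) β

flipCmp : Cmp → Cmp
flipCmp lt = gt
flipCmp eq = eq
flipCmp gt = lt

lexi-flip : ∀ c d → lexi (flipCmp c) (flipCmp d) ≡ flipCmp (lexi c d)
lexi-flip lt d = refl
lexi-flip eq d = refl
lexi-flip gt d = refl

lexi-eq⁻ : ∀ {c d} → lexi c d ≡ eq → c ≡ eq × d ≡ eq
lexi-eq⁻ {eq} e = refl , e

lexi-lt⁻ : ∀ {c d} → lexi c d ≡ lt → c ≡ lt ⊎ (c ≡ eq × d ≡ lt)
lexi-lt⁻ {lt} _ = inj₁ refl
lexi-lt⁻ {eq} e = inj₂ (refl , e)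

cmpℕ-swap : ∀ m n → cmpℕ n m ≡ flipCmp (cmpℕ m n)
cmpℕ-swap zero    zero    = refl
cmpℕ-swap zero    (suc n) = refl
cmpℕ-swap (suc m) zero    = refl
cmpℕ-swap (suc m) (suc n) = cmpℕ-swap m n

cmpℕ-eq⇒≡ : ∀ {m n} → cmpℕ m n ≡ eq → m ≡ n
cmpℕ-eq⇒≡ {zero}  {zero}  _ = refl
cmpℕ-eq⇒≡ {suc m} {suc n} e = cong suc (cmpℕ-eq⇒≡ e)

mutual
  cmpP-swap : ∀ p q → cmpP q p ≡ flipCmp (cmpP p q)
  cmpP-swap one     one     = refl
  cmpP-swap one     (ψ _ _) = refl
  cmpP-swap (ψ _ _) one     = refl
  cmpP-swap (ψ i α) (ψ j β)
    rewrite cmpℕ-swap (toℕ i) (toℕ j) | cmpL-swap α β = lexi-flip (cmpℕ (toℕ i) (toℕ j)) (cmpL α β)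

  cmpL-swap : ∀ α β → cmpL β α ≡ flipCmp (cmpL α β)
  cmpL-swap []       []       = refl
  cmpL-swap []       (_ ∷ _)  = refl
  cmpL-swap (_ ∷ _)  []       = refl
  cmpL-swap (p ∷ α) (q ∷ β)
    rewrite cmpP-swap p q | cmpL-swap α β = lexi-flip (cmpP p q) (cmpL α β)

mutual
  cmpP-eq⇒≡ : ∀ {p q} → cmpP p q ≡ eq → p ≡ q
  cmpP-eq⇒≡ {one}   {one}   _ = refl
  cmpP-eq⇒≡ {ψ i α} {ψ j β} e with lexi-eq⁻ {cmpℕ (toℕ i) (toℕ j)} e
  ... | i≈j , α≈β = cong₂ ψ (toℕ-injective (cmpℕ-eq⇒≡ i≈j)) (cmpL-eq⇒≡ α≈β)

  cmpL-eq⇒≡ : ∀ {α β} → cmpL α β ≡ eq → α ≡ β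
  cmpL-eq⇒≡ {[]}    {[]}    _ = refl
  cmpL-eq⇒≡ {p ∷ α} {q ∷ β} e with lexi-eq⁻ {cmpP p q} e
  ... | p≈q , α≈β = cong₂ _∷_ (cmpP-eq⇒≡ p≈q) (cmpL-eq⇒≡ α≈β)

module StrictOrder {A : Set} (cmp : A → A → Cmp)
    (cmp-swap : ∀ a b → cmp b a ≡ flipCmp (cmp a b))
    (cmp-eq⇒≡ : ∀ {a b} → cmp a b ≡ eq → a ≡ b) where

  _≺_ : A → A → Set
  a ≺ b = cmp a b ≡ lt

  cmp-refl : ∀ a → cmp a a ≡ eq
  cmp-refl a with cmp a a | cmp-swap a a
  ... | lt | ()
  ... | eq | _  = refl
  ... | gt | ()

  ≺-irrefl : ∀ {a} → ¬ a ≺ a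
  ≺-irrefl {a} a≺a = case trans (sym a≺a) (cmp-refl a) of λ ()

  ≺-asym : ∀ {a b} → a ≺ b → ¬ b ≺ a
  ≺-asym {a} {b} a≺b b≺a = case trans (sym b≺a) (trans (cmp-swap a b) (cong flipCmp a≺b)) of λ ()

  ≺-cmp : ∀ a b → Tri (a ≺ b) (a ≡ b) (b ≺ a)
  ≺-cmp a b with cmp a b in e
  ... | lt = tri< refl (λ { refl → ≺-irrefl e }) (≺-asym e)
  ... | eq = tri≈ (λ ()) a≡b (λ b≺a → ≺-irrefl (subst (b ≺_) a≡b b≺a))
    where a≡b = cmp-eq⇒≡ e
  ... | gt = tri> (λ ()) (λ { refl → ≺-irrefl b≺a }) b≺a
    where b≺a = trans (cmp-swap a b) (cong flipCmp e)

  ≮-antisym : ∀ {a b} → ¬ b ≺ a → ¬ a ≺ b → a ≡ b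
  ≮-antisym {a} {b} b⊀a a⊀b with ≺-cmp a b
  ... | tri< a≺b _ _ = ⊥-elim (a⊀b a≺b)
  ... | tri≈ _ a≡b _ = a≡b
  ... | tri> _ _ b≺a = ⊥-elim (b⊀a b≺a)

  ≮∧≢⇒≺ : ∀ {a b} → ¬ b ≺ a → a ≢ b → a ≺ b
  ≮∧≢⇒≺ {a} {b} b⊀a a≢b with ≺-cmp a b
  ... | tri< a≺b _ _ = a≺b
  ... | tri≈ _ a≡b _ = ⊥-elim (a≢b a≡b)
  ... | tri> _ _ b≺a = ⊥-elim (b⊀a b≺a)

-- _<ₚ_ and _<ₒ_ unfold to equations between cmp-values, from which Agda cannot recover the
-- compared terms; hence the many explicitly given implicit arguments below.
open StrictOrder cmpP cmpP-swap cmpP-eq⇒≡ using ()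
  renaming (_≺_ to _<ₚ_; cmp-refl to cmpP-refl; ≺-irrefl to <ₚ-irrefl; ≺-asym to <ₚ-asym;
            ≺-cmp to <ₚ-cmp)
open StrictOrder cmpL cmpL-swap cmpL-eq⇒≡ using ()
  renaming (≺-asym to <ₒ-asym; ≺-cmp to <ₒ-cmp; ≮-antisym to ≤ₒ-antisym; ≮∧≢⇒≺ to ≤ₒ∧≢⇒<ₒ)

T-∧⁻ : ∀ {x y} → T (x ∧ y) → T x × T y
T-∧⁻ = Equivalence.to T-∧

OT-head : ∀ p ps → OT (p ∷ ps) → T (isOTₚ p)
OT-head p ps o = proj₁ (T-∧⁻ {isOTₚ p} (proj₂ (T-∧⁻ {decr (p ∷ ps)} o)))

OT-tail : ∀ p ps → OT (p ∷ ps) → OT ps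
OT-tail p []       _ = _
OT-tail p (q ∷ ps) o with T-∧⁻ {decr (p ∷ q ∷ ps)} o
... | d , a = Equivalence.from T-∧ (proj₂ (T-∧⁻ {not (p <ₚᵇ q)} d) , proj₂ (T-∧⁻ {isOTₚ p} a))

OT-sorted : ∀ p q ps → OT (p ∷ q ∷ ps) → ¬ p <ₚ q
OT-sorted p q ps o p<q =
  subst (λ c → T (not (isLt c))) p<q
    (proj₁ (T-∧⁻ {not (p <ₚᵇ q)} (proj₁ (T-∧⁻ {decr (p ∷ q ∷ ps)} o))))

OTₚ-arg : ∀ i β → T (isOTₚ (ψ i β)) → OT β
OTₚ-arg Fin.zero                     β o = proj₁ (T-∧⁻ {isOT β} o)
OTₚ-arg (Fin.suc Fin.zero)           β o = proj₁ (T-∧⁻ {isOT β} o)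
OTₚ-arg (Fin.suc (Fin.suc Fin.zero)) β o = o

-- x ≽ c is exactly what keeps (x ∷ []) ⊕ c from absorbing summands of c.
infix 4 _≻_ _≽_

_≻_ : Prin → Tm → Set
x ≻ []      = ⊤
x ≻ (y ∷ _) = y <ₚ x

_≽_ : Prin → Tm → Set
x ≽ []      = ⊤
x ≽ (y ∷ _) = ¬ x <ₚ y

≻⇒≽ : ∀ {x} c → x ≻ c → x ≽ c
≻⇒≽     []      _   = tt
≻⇒≽ {x} (y ∷ _) y<x = <ₚ-asym {y} {x} y<x

≻⇒<ₒ∷ : ∀ {x r} c → x ≻ c → c <ₒ x ∷ r
≻⇒<ₒ∷ []      _              = refl
≻⇒<ₒ∷ (_ ∷ _) y<x rewrite y<x = refl

<ₒ∷⇒≽ : ∀ {x r} c → c <ₒ x ∷ r → x ≽ c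
<ₒ∷⇒≽ []       _     = tt
<ₒ∷⇒≽ {x} (y ∷ ys) c<x∷r x<y with lexi-lt⁻ {cmpP y x} c<x∷r
... | inj₁ y<x = <ₚ-asym {x} {y} x<y y<x
... | inj₂ (y≈x , _) with refl ← cmpP-eq⇒≡ {y} {x} y≈x = <ₚ-irrefl {x} x<y

<ₚ⇒∷<ₒ∷ : ∀ {x y xs ys} → x <ₚ y → x ∷ xs <ₒ y ∷ ys
<ₚ⇒∷<ₒ∷ x<y rewrite x<y = refl

++-monoʳ-<ₒ : ∀ xs {ys zs} → ys <ₒ zs → xs ++ ys <ₒ xs ++ zs
++-monoʳ-<ₒ []       ys<zs = ys<zs
++-monoʳ-<ₒ (x ∷ xs) ys<zs rewrite cmpP-refl x = ++-monoʳ-<ₒ xs ys<zs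

∷-lex-<ₒ : ∀ {p q ps qs x y xs ys} → p ∷ ps <ₒ q ∷ qs →
           (p <ₚ q → x <ₚ y) → (p ≡ q → x ≡ y) → (ps <ₒ qs → xs <ₒ ys) →
           x ∷ xs <ₒ y ∷ ys
∷-lex-<ₒ {p} {q} {ps} {qs} {x} {y} {xs} {ys} p∷ps<q∷qs mono-head fun-head mono-tail
  with lexi-lt⁻ {cmpP p q} p∷ps<q∷qs
... | inj₁ p<q = <ₚ⇒∷<ₒ∷ {x} {y} {xs} {ys} (mono-head p<q)
... | inj₂ (p≈q , ps<qs) with refl ← fun-head (cmpP-eq⇒≡ {p} {q} p≈q) =
  ++-monoʳ-<ₒ (x ∷ []) {xs} {ys} (mono-tail ps<qs)

replicate-<ₒ-head : ∀ {p p' x y c c'} → 1 ≤ p → 1 ≤ p' → x <ₚ y →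
                    replicate p x ++ c <ₒ replicate p' y ++ c'
replicate-<ₒ-head {suc p} {suc p'} {x} {y} {c} {c'} _ _ =
  <ₚ⇒∷<ₒ∷ {x} {y} {replicate p x ++ c} {replicate p' y ++ c'}

replicate-<ₒ-length : ∀ {x c c'} p p' → x ≻ c → p < p' → replicate p x ++ c <ₒ replicate p' x ++ c'
replicate-<ₒ-length {c = c} zero (suc _) x≻c _ = ≻⇒<ₒ∷ c x≻c
replicate-<ₒ-length {x} (suc p) (suc p') x≻c (s≤s p<p')
  rewrite cmpP-refl x = replicate-<ₒ-length p p' x≻c p<p'

≻-replicate : ∀ {p x y c} → 1 ≤ p → y <ₚ x → x ≻ replicate p y ++ c
≻-replicate {suc _} _ y<x = y<x

nat-mono-< : ∀ {m n} → m < n → nat m <ₒ nat n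
nat-mono-< {zero}  {suc _} _         = refl
nat-mono-< {suc _} {suc _} (s≤s m<n) = nat-mono-< m<n

nat-cancel-< : ∀ m n → nat m <ₒ nat n → m < n
nat-cancel-< zero    (suc n) _   = s≤s z≤n
nat-cancel-< (suc m) (suc n) m<n = s≤s (nat-cancel-< m n m<n)

nat<ψ∷ : ∀ m {i β r} → nat m <ₒ ψ i β ∷ r
nat<ψ∷ zero    = refl
nat<ψ∷ (suc _) = refl

nat-injective : ∀ m n → nat m ≡ nat n → m ≡ n
nat-injective m n e = trans (sym (length-replicate m)) (trans (cong length e) (length-replicate n))

nat≢ψ∷ : ∀ l {i β r} → nat l ≢ ψ i β ∷ r
nat≢ψ∷ zero    ()
nat≢ψ∷ (suc _) ()

keepGe-one : ∀ α → keepGe one α ≡ α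
keepGe-one []          = refl
keepGe-one (one ∷ α)   = cong (one ∷_) (keepGe-one α)
keepGe-one (ψ i β ∷ α) = cong (ψ i β ∷_) (keepGe-one α)

⊕one≡∷ʳ : ∀ α → α ⊕ (one ∷ []) ≡ α ∷ʳ one
⊕one≡∷ʳ α = cong (_++ one ∷ []) (keepGe-one α)

⊕one≢[] : ∀ α → α ⊕ (one ∷ []) ≢ []
⊕one≢[] α e = case ++-conicalʳ (keepGe one α) (one ∷ []) e of λ ()

⊕one-injective : ∀ {α β} → α ⊕ (one ∷ []) ≡ β ⊕ (one ∷ []) → α ≡ β
⊕one-injective {α} {β} e = ∷ʳ-injectiveˡ α β (trans (sym (⊕one≡∷ʳ α)) (trans e (⊕one≡∷ʳ β)))

tp-∷ʳ-one : ∀ α → tp (α ∷ʳ one) ≡ one ∷ []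
tp-∷ʳ-one []          = refl
tp-∷ʳ-one (_ ∷ [])    = refl
tp-∷ʳ-one (_ ∷ y ∷ α) = tp-∷ʳ-one (y ∷ α)

tp-⊕one≢ω : ∀ α → tp (α ⊕ (one ∷ [])) ≢ ω
tp-⊕one≢ω α e = case trans (sym (tp-∷ʳ-one α)) (trans (cong tp (sym (⊕one≡∷ʳ α))) e) of λ ()

isLt-≢lt : ∀ {c} → c ≢ lt → isLt c ≡ false
isLt-≢lt {lt} c≢lt = ⊥-elim (c≢lt refl)
isLt-≢lt {eq} _    = refl
isLt-≢lt {gt} _    = refl

keepGe-replicate : ∀ {x y} p → ¬ x <ₚ y → keepGe y (replicate p x) ≡ replicate p x
keepGe-replicate zero    _   = refl
keepGe-replicate {x} (suc p) x≮y rewrite isLt-≢lt x≮y = cong (x ∷_) (keepGe-replicate p x≮y)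

replicate-⊕ : ∀ {x} p c → x ≽ c → replicate p x ⊕ c ≡ replicate p x ++ c
replicate-⊕ p []      _   = sym (++-identityʳ _)
replicate-⊕ p (_ ∷ _) x≽c = cong (_++ _) (keepGe-replicate p x≽c)

∷-⊕ : ∀ {x} c → x ≽ c → (x ∷ []) ⊕ c ≡ x ∷ c
∷-⊕ = replicate-⊕ 1

replicate-∷ʳ : ∀ p (x : Prin) → replicate p x ∷ʳ x ≡ x ∷ replicate p x
replicate-∷ʳ zero    x = refl
replicate-∷ʳ (suc p) x = cong (x ∷_) (replicate-∷ʳ p x)

·-replicate : ∀ x p → (x ∷ []) · p ≡ replicate p x
·-replicate x zero    = refl
·-replicate x (suc p) = begin
  ((x ∷ []) · p) ⊕ (x ∷ [])   ≡⟨ cong (_⊕ (x ∷ [])) (·-replicate x p) ⟩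
  replicate p x ⊕ (x ∷ [])    ≡⟨ replicate-⊕ p (x ∷ []) (<ₚ-irrefl {x}) ⟩
  replicate p x ∷ʳ x          ≡⟨ replicate-∷ʳ p x ⟩
  x ∷ replicate p x           ∎
  where open ≡-Reasoning

·-⊕ : ∀ {x} p c → x ≽ c → ((x ∷ []) · p) ⊕ c ≡ replicate p x ++ c
·-⊕ {x} p c x≽c = trans (cong (_⊕ c) (·-replicate x p)) (replicate-⊕ p c x≽c)

⊕-conicalʳ : ∀ xs ys → xs ⊕ ys ≡ [] → ys ≡ []
⊕-conicalʳ xs []       _ = refl
⊕-conicalʳ xs (y ∷ ys) e = ++-conicalʳ (keepGe y xs) (y ∷ ys) e

⊕-conicalˡ : ∀ xs ys → xs ⊕ ys ≡ [] → xs ≡ []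
⊕-conicalˡ xs []       e = e
⊕-conicalˡ xs (y ∷ ys) e = case ⊕-conicalʳ xs (y ∷ ys) e of λ ()

·-conical : ∀ xs p → 1 ≤ p → xs · p ≡ [] → xs ≡ []
·-conical xs (suc p) _ e = ⊕-conicalʳ (xs · p) xs e

keepGe⁺ : ∀ {P : Prin → Set} b xs → All P xs → All P (keepGe b xs)
keepGe⁺ b []       _           = []
keepGe⁺ b (a ∷ as) (pa ∷ pas) with a <ₚᵇ b
... | true  = []
... | false = pa ∷ keepGe⁺ b as pas

⊕⁺ : ∀ {P : Prin → Set} xs ys → All P xs → All P ys → All P (xs ⊕ ys)
⊕⁺ xs []       pxs _   = pxs
⊕⁺ xs (y ∷ ys) pxs pys = ++⁺ (keepGe⁺ y xs pxs) pys

·⁺ : ∀ {P : Prin → Set} xs p → All P xs → All P (xs · p)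
·⁺ xs zero    _   = []
·⁺ xs (suc p) pxs = ⊕⁺ (xs · p) xs (·⁺ xs p pxs) pxs

*+-<-by-quotient : ∀ {h p q p' q'} → q < h → p < p' → h * p + q < h * p' + q'
*+-<-by-quotient {h} {p} {q} {p'} {q'} q<h p<p' = begin-strict
  h * p + q    <⟨ +-monoʳ-< (h * p) q<h ⟩
  h * p + h    ≡⟨ +-comm (h * p) h ⟩
  h + h * p    ≡⟨ *-suc h p ⟨
  h * suc p    ≤⟨ *-monoʳ-≤ h p<p' ⟩
  h * p'       ≤⟨ m≤m+n (h * p') q' ⟩
  h * p' + q'  ∎
  where open ≤-Reasoning

*+-<-lex : ∀ {h p q p' q'} → q' < h → h * p + q < h * p' + q' → p < p' ⊎ (p ≡ p' × q < q')
*+-<-lex {h} {p} {q} {p'} {q'} q'<h m<n with <-cmp p p'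
... | tri< p<p' _ _ = inj₁ p<p'
... | tri≈ _ refl _ = inj₂ (refl , +-cancelˡ-< (h * p) q q' m<n)
... | tri> _ _ p'<p = ⊥-elim (<-asym m<n (*+-<-by-quotient q'<h p'<p))

*+-injective : ∀ {h p q p' q'} → q < h → q' < h → h * p + q ≡ h * p' + q' → p ≡ p' × q ≡ q'
*+-injective {h} {p} {q} {p'} {q'} q<h q'<h e with <-cmp p p'
... | tri< p<p' _ _ = ⊥-elim (<-irrefl e (*+-<-by-quotient q<h p<p'))
... | tri≈ _ refl _ = refl , +-cancelˡ-≡ (h * p) q q' e
... | tri> _ _ p'<p = ⊥-elim (<-irrefl (sym e) (*+-<-by-quotient q'<h p'<p))

mutual
  Hardy-functional : ∀ {k α α' v v'} → Hardy k α v → Hardy k α' v' → α ≡ α' → v ≡ v'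
  Hardy-functional H-zero            H-zero              _    = refl
  Hardy-functional H-zero            (H-suc {α = α} _)   e    = ⊥-elim (⊕one≢[] α (sym e))
  Hardy-functional H-zero            (H-lim () _ _)      refl
  Hardy-functional (H-suc {α = α} _) H-zero              e    = ⊥-elim (⊕one≢[] α e)
  Hardy-functional {k} (H-suc h)     (H-suc h')          e    =
    cong (_* k) (Hardy-functional h h' (⊕one-injective e))
  Hardy-functional (H-suc {α = α} _) (H-lim tp≡ω _ _)    refl = ⊥-elim (tp-⊕one≢ω α tp≡ω)
  Hardy-functional (H-lim () _ _)    H-zero              refl
  Hardy-functional (H-lim tp≡ω _ _)  (H-suc {α = α} _)   refl = ⊥-elim (tp-⊕one≢ω α tp≡ω)
  Hardy-functional (H-lim _ b h)     (H-lim _ b' h')     refl =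
    Hardy-functional h h' (Braces-functional b b')

  Braces-functional : ∀ {k λ' b μ μ'} → Braces k λ' b μ → Braces k λ' b μ' → μ ≡ μ'
  Braces-functional B-zero B-zero = refl
  Braces-functional {λ' = λ'} (B-suc b h) (B-suc b' h') =
    cong (λ v → fs λ' (nat v)) (Hardy-functional h h' (Braces-functional b b'))

module _ {k m α p q} (nf : IsNF k m α p q) where
  open IsNF nf

  IsNF-OT : OT α
  IsNF-OT = proj₁ α-OT₀

  IsNF-q≤m : q ≤ m
  IsNF-q≤m = subst (q ≤_) (sym decomp) (m≤n+m q (h * p))

  IsNF-α-mono : ∀ {n β p' q'} → IsNF k n β p' q' → n ≤ m → β ≤ₒ α
  IsNF-α-mono nf' n≤m =
    largest _ (IsNF.h nf') (IsNF.α-OT₀ nf') (IsNF.α<Ω nf') (IsNF.hardy nf')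
      (≤-trans (IsNF.h≤m nf') n≤m)

  IsNF-same-α : ∀ {n p' q'} → IsNF k n α p' q' → n ≡ h * p' + q' × q' < h
  IsNF-same-α {p' = p'} {q'} nf' =
    trans (IsNF.decomp nf') (cong (λ h' → h' * p' + q') h'≡h) , subst (q' <_) h'≡h (IsNF.q<h nf')
    where h'≡h = Hardy-functional (IsNF.hardy nf') hardy refl

  IsNF-lex : ∀ {n p' q'} → IsNF k n α p' q' → m < n → p < p' ⊎ (p ≡ p' × q < q')
  IsNF-lex nf' m<n with IsNF-same-α nf'
  ... | n≡ , q'<h = *+-<-lex q'<h (subst₂ _<_ decomp n≡ m<n)

  IsNF-remainder-α< : ∀ {β p' q'} → IsNF k q β p' q' → β <ₒ α
  IsNF-remainder-α< nf' = ≤ₒ∧≢⇒<ₒ (IsNF-α-mono nf' IsNF-q≤m) β≢α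
    where
    β≢α : _ ≢ α
    β≢α refl = <⇒≱ q<h (subst (_≤ q) (Hardy-functional (IsNF.hardy nf') hardy refl) (IsNF.h≤m nf'))

IsNF-unique : ∀ {k m α p q α' p' q'} → IsNF k m α p q → IsNF k m α' p' q' → α ≡ α' × p ≡ p' × q ≡ q'
IsNF-unique {α = α} {α' = α'} nf nf'
  with refl ← ≤ₒ-antisym {α} {α'} (IsNF-α-mono nf' nf ≤-refl) (IsNF-α-mono nf nf' ≤-refl)
  with IsNF-same-α nf nf'
... | m≡ , q'<h = refl , *+-injective (IsNF.q<h nf) q'<h (trans (sym (IsNF.decomp nf)) m≡)

OkP-singleton : ∀ {k p a} → OkP k p a → Σ Prin (λ x → a ≡ x ∷ [])
OkP-singleton (p-ψ₀ {b = b} _) = ψ₁ b , refl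
OkP-singleton (p-ψ₁ {b = b} _) = ψ₂ b , refl

mutual
  OkN-functional : ∀ {k m c c'} → OkN k m c → OkN k m c' → c ≡ c'
  OkN-functional (n-small _)     (n-small _)       = refl
  OkN-functional (n-small k<k)   n-k               = ⊥-elim (<-irrefl refl k<k)
  OkN-functional (n-small m<k)   (n-big k<m _ _ _) = ⊥-elim (<-asym m<k k<m)
  OkN-functional n-k             (n-small k<k)     = ⊥-elim (<-irrefl refl k<k)
  OkN-functional n-k             n-k               = refl
  OkN-functional n-k             (n-big k<k _ _ _) = ⊥-elim (<-irrefl refl k<k)
  OkN-functional (n-big k<m _ _ _) (n-small m<k)   = ⊥-elim (<-asym m<k k<m)
  OkN-functional (n-big k<k _ _ _) n-k             = ⊥-elim (<-irrefl refl k<k)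
  OkN-functional (n-big {p = p} _ nf dα dq) (n-big _ nf' dα' dq') with IsNF-unique nf nf'
  ... | refl , refl , refl =
    cong₂ (λ a c → ((ψ₀ a ∷ []) · p) ⊕ c) (OkT-functional dα dα' refl) (OkN-functional dq dq')

  OkT-functional : ∀ {k α α' a a'} → OkT k α a → OkT k α' a' → α ≡ α' → a ≡ a'
  OkT-functional (t-nat {l} dl)  (t-nat {l'} dl') e
    with refl ← nat-injective l l' e = OkN-functional dl dl'
  OkT-functional (t-nat {l} _)   (t-cons _ _)     e = ⊥-elim (nat≢ψ∷ l e)
  OkT-functional (t-cons _ _)    (t-nat {l} _)    e = ⊥-elim (nat≢ψ∷ l (sym e))
  OkT-functional (t-cons dp dr)  (t-cons dp' dr') refl =
    cong₂ _⊕_ (OkP-functional dp dp') (OkT-functional dr dr' refl)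

  OkP-functional : ∀ {k p a a'} → OkP k p a → OkP k p a' → a ≡ a'
  OkP-functional (p-ψ₀ d) (p-ψ₀ d') = cong (λ b → ψ₁ b ∷ []) (OkT-functional d d' refl)
  OkP-functional (p-ψ₁ d) (p-ψ₁ d') = cong (λ b → ψ₂ b ∷ []) (OkT-functional d d' refl)

OkN-[]⇒0 : ∀ {k m c} → OkN k m c → c ≡ [] → m ≡ 0
OkN-[]⇒0 (n-small {zero} _) _ = refl
OkN-[]⇒0 (n-big {p = p} {a = a} {c = c} _ nf _ _) e =
  case ·-conical (ψ₀ a ∷ []) p (IsNF.1≤p nf) (⊕-conicalˡ ((ψ₀ a ∷ []) · p) c e) of λ ()

OkT-[]⇒[] : ∀ {k α a} → OkT k α a → a ≡ [] → α ≡ []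
OkT-[]⇒[] (t-nat dl)             e = cong nat (OkN-[]⇒0 dl e)
OkT-[]⇒[] (t-cons {c = c} (p-ψ₀ {b = b} _) _) e = case ⊕-conicalˡ (ψ₁ b ∷ []) c e of λ ()
OkT-[]⇒[] (t-cons {c = c} (p-ψ₁ {b = b} _) _) e = case ⊕-conicalˡ (ψ₂ b ∷ []) c e of λ ()

BelowΩₚ : Prin → Set
BelowΩₚ one               = ⊤
BelowΩₚ (ψ₀ _)            = ⊤
BelowΩₚ (ψ (Fin.suc _) _) = ⊥

BelowΩ : Tm → Set
BelowΩ = All BelowΩₚ

OkN-belowΩ : ∀ {k m c} → OkN k m c → BelowΩ c
OkN-belowΩ (n-small {m} _)          = replicate⁺ m tt
OkN-belowΩ n-k                      = tt ∷ []
OkN-belowΩ (n-big {p = p} _ _ _ dq) = ⊕⁺ _ _ (·⁺ _ p (tt ∷ [])) (OkN-belowΩ dq)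

belowΩ-<ψ₁₊ : ∀ {c j β r} → BelowΩ c → c <ₒ ψ (Fin.suc j) β ∷ r
belowΩ-<ψ₁₊ {[]}                  []      = refl
belowΩ-<ψ₁₊ {one ∷ _}             (_ ∷ _) = refl
belowΩ-<ψ₁₊ {ψ₀ _ ∷ _}            (_ ∷ _) = refl
belowΩ-<ψ₁₊ {ψ (Fin.suc _) _ ∷ _} (() ∷ _)

belowΩ-<-OkP : ∀ {k c p x r} → BelowΩ c → OkP k p (x ∷ []) → c <ₒ x ∷ r
belowΩ-<-OkP c<Ω (p-ψ₀ _) = belowΩ-<ψ₁₊ c<Ω
belowΩ-<-OkP c<Ω (p-ψ₁ _) = belowΩ-<ψ₁₊ c<Ω

nat<ψ₀-sum : ∀ m {p b c} → 1 ≤ p → nat m <ₒ replicate p (ψ₀ b) ++ c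
nat<ψ₀-sum m {suc _} _ = nat<ψ∷ m

-- o_k(k) = ω is below o_k(n) for n > k, since o_k(n) = ω would force n = H₀(k) · 1 + 0 = k.
ω<OkN-big : ∀ {k n β p q b c} → k < n → IsNF k n β p q → OkT k β b → OkN k q c →
            ω <ₒ replicate p (ψ₀ b) ++ c
ω<OkN-big {p = zero} _ nf _ _ = case IsNF.1≤p nf of λ ()
ω<OkN-big {p = suc _}       {b = _ ∷ _}            _ _ _ _ = refl
ω<OkN-big {p = suc (suc _)} {b = []}               _ _ _ _ = refl
ω<OkN-big {p = 1}           {b = []}   {c = _ ∷ _} _ _ _ _ = refl
ω<OkN-big {k} {n} {p = 1} {q} {b = []} {c = []} k<n nf dβ dq = ⊥-elim (<-irrefl (sym n≡k) k<n)
  where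
  open ≡-Reasoning
  h≡k : IsNF.h nf ≡ k
  h≡k = Hardy-functional (IsNF.hardy nf) H-zero (OkT-[]⇒[] dβ refl)
  n≡k : n ≡ k
  n≡k = begin
    n                 ≡⟨ IsNF.decomp nf ⟩
    IsNF.h nf * 1 + q ≡⟨ cong₂ (λ h r → h * 1 + r) h≡k (OkN-[]⇒0 dq refl) ⟩
    k * 1 + 0         ≡⟨ +-identityʳ (k * 1) ⟩
    k * 1             ≡⟨ *-identityʳ k ⟩
    k                 ∎

ψ₀≻ω : ∀ {k m α p a} → IsNF k m α p k → OkT k α a → ψ₀ a ≻ ω
ψ₀≻ω {a = _ ∷ _} _  _  = refl
ψ₀≻ω {a = []}    nf dα = ⊥-elim (<-irrefl (sym h≡k) (IsNF.q<h nf))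
  where h≡k = Hardy-functional (IsNF.hardy nf) H-zero (OkT-[]⇒[] dα refl)

OkN-big-mono : ∀ {k m n α β p p' q q' a b c c'} →
               IsNF k m α p q → IsNF k n β p' q' → m < n → OkT k α a → OkT k β b → ψ₀ a ≻ c →
               (α <ₒ β → a <ₒ b) → (q < q' → c <ₒ c') →
               replicate p (ψ₀ a) ++ c <ₒ replicate p' (ψ₀ b) ++ c'
OkN-big-mono {α = α} {β} {p} {p'} {a = a} {c = c} {c'} nf nf' m<n dα dβ a≻c mono-α mono-q
  with <ₒ-cmp α β
... | tri< α<β _ _ = replicate-<ₒ-head (IsNF.1≤p nf) (IsNF.1≤p nf') (mono-α α<β)
... | tri> _ _ β<α = ⊥-elim (IsNF-α-mono nf' nf (<⇒≤ m<n) β<α)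
... | tri≈ _ refl _ with refl ← OkT-functional dα dβ refl with IsNF-lex nf nf' m<n
...   | inj₁ p<p'          = replicate-<ₒ-length {ψ₀ a} {c} {c'} p p' a≻c p<p'
...   | inj₂ (refl , q<q') = ++-monoʳ-<ₒ (replicate p (ψ₀ a)) {c} {c'} (mono-q q<q')

mutual
  OkN-mono : ∀ {k m n a b} → m < n → OkN k m a → OkN k n b → a <ₒ b
  OkN-mono m<n (n-small _)     (n-small _)         = nat-mono-< m<n
  OkN-mono _   (n-small {m} _) n-k                 = nat<ψ∷ m
  OkN-mono _   (n-small {m} _) (n-big _ nf dβ dq)
    rewrite OkN-big-⊕≡++ nf dβ dq = nat<ψ₀-sum m (IsNF.1≤p nf)
  OkN-mono m<n n-k             (n-small n<k)       = ⊥-elim (<-asym m<n n<k)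
  OkN-mono k<k n-k             n-k                 = ⊥-elim (<-irrefl refl k<k)
  OkN-mono _   n-k             (n-big k<n nf dβ dq)
    rewrite OkN-big-⊕≡++ nf dβ dq = ω<OkN-big k<n nf dβ dq
  OkN-mono m<n (n-big k<m _ _ _) (n-small n<k)     = ⊥-elim (<-asym k<m (<-trans m<n n<k))
  OkN-mono m<k (n-big k<m _ _ _) n-k               = ⊥-elim (<-asym k<m m<k)
  OkN-mono m<n (n-big _ nf dα dq) (n-big _ nf' dβ dq')
    rewrite OkN-big-⊕≡++ nf dα dq | OkN-big-⊕≡++ nf' dβ dq' =
      OkN-big-mono nf nf' m<n dα dβ (ψ₀≻OkN-remainder nf dα dq)
        (λ α<β → OkT-mono (IsNF-OT nf) (IsNF-OT nf') α<β dα dβ)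
        (λ q<q' → OkN-mono q<q' dq dq')

  -- q < H_α(k) puts the level of q below α.
  ψ₀≻OkN-remainder : ∀ {k m α p q a c} → IsNF k m α p q → OkT k α a → OkN k q c → ψ₀ a ≻ c
  ψ₀≻OkN-remainder _  _  (n-small {zero} _)  = tt
  ψ₀≻OkN-remainder _  _  (n-small {suc _} _) = refl
  ψ₀≻OkN-remainder nf dα n-k                 = ψ₀≻ω nf dα
  ψ₀≻OkN-remainder nf dα (n-big _ nf' dα' dq')
    rewrite OkN-big-⊕≡++ nf' dα' dq' =
      ≻-replicate (IsNF.1≤p nf')
        (OkT-mono (IsNF-OT nf') (IsNF-OT nf) (IsNF-remainder-α< nf nf') dα' dα)

  OkN-big-⊕≡++ : ∀ {k m α p q a c} → IsNF k m α p q → OkT k α a → OkN k q c →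
                 ((ψ₀ a ∷ []) · p) ⊕ c ≡ replicate p (ψ₀ a) ++ c
  OkN-big-⊕≡++ {p = p} {c = c} nf dα dq = ·-⊕ p c (≻⇒≽ c (ψ₀≻OkN-remainder nf dα dq))

  OkT-mono : ∀ {k α β a b} → OT α → OT β → α <ₒ β → OkT k α a → OkT k β b → a <ₒ b
  OkT-mono _  _  α<β (t-nat {l} dl) (t-nat {l'} dl') = OkN-mono (nat-cancel-< l l' α<β) dl dl'
  OkT-mono _  oβ _   (t-nat dl)     (t-cons {c = c} dq dr) with OkP-singleton dq
  ... | _ , refl rewrite ∷-⊕ c (OkT-∷-≽ oβ dq dr) = belowΩ-<-OkP {r = c} (OkN-belowΩ dl) dq
  OkT-mono _  _  α<β (t-cons {i} {γ} {r} _ _) (t-nat {l} _) =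
    ⊥-elim (<ₒ-asym {nat l} {ψ i γ ∷ r} (nat<ψ∷ l) α<β)
  OkT-mono oα oβ α<β (t-cons {i} {γ} {r} {c = c} dp dr) (t-cons {j} {δ} {r′} {c = c′} dq dr′)
    with OkP-singleton dp | OkP-singleton dq
  ... | x , refl | y , refl rewrite ∷-⊕ c (OkT-∷-≽ oα dp dr) | ∷-⊕ c′ (OkT-∷-≽ oβ dq dr′) =
    ∷-lex-<ₒ {ψ i γ} {ψ j δ} {r} {r′} {x} {y} {c} {c′} α<β
      (OkP-mono (OT-head (ψ i γ) r oα) (OT-head (ψ j δ) r′ oβ) dp dq)
      (λ { refl → ∷-injectiveˡ (OkP-functional dp dq) })
      (λ r<r′ → OkT-mono (OT-tail (ψ i γ) r oα) (OT-tail (ψ j δ) r′ oβ) r<r′ dr dr′)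

  OkP-mono : ∀ {k p q x y} → T (isOTₚ p) → T (isOTₚ q) →
             OkP k p (x ∷ []) → OkP k q (y ∷ []) → p <ₚ q → x <ₚ y
  OkP-mono op oq (p-ψ₀ {γ} dγ) (p-ψ₀ {δ} dδ) γ<δ =
    OkT-mono (OTₚ-arg Fin.zero γ op) (OTₚ-arg Fin.zero δ oq) γ<δ dγ dδ
  OkP-mono _  _  (p-ψ₀ _)  (p-ψ₁ _)  _   = refl
  OkP-mono _  _  (p-ψ₁ _)  (p-ψ₀ _)  ()
  OkP-mono op oq (p-ψ₁ {γ} dγ) (p-ψ₁ {δ} dδ) γ<δ =
    OkT-mono (OTₚ-arg (Fin.suc Fin.zero) γ op) (OTₚ-arg (Fin.suc Fin.zero) δ oq) γ<δ dγ dδ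

  OkP-cancel-< : ∀ {k p q x y} → T (isOTₚ p) → T (isOTₚ q) →
                 OkP k p (x ∷ []) → OkP k q (y ∷ []) → x <ₚ y → p <ₚ q
  OkP-cancel-< {p = p} {q} {x} {y} op oq dp dq x<y with <ₚ-cmp p q
  ... | tri< p<q _ _ = p<q
  ... | tri≈ _ refl _ with refl ← OkP-functional dp dq = ⊥-elim (<ₚ-irrefl {x} x<y)
  ... | tri> _ _ q<p = ⊥-elim (<ₚ-asym {x} {y} x<y (OkP-mono oq op dq dp q<p))

  OkT-∷-≽ : ∀ {k p rest x c} → OT (p ∷ rest) → OkP k p (x ∷ []) → OkT k rest c → x ≽ c
  OkT-∷-≽ _ dp (t-nat dl) = <ₒ∷⇒≽ _ (belowΩ-<-OkP {r = []} (OkN-belowΩ dl) dp)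
  OkT-∷-≽ {p = p} o dp (t-cons {i} {β} {rest} dq dr)
    with OT-tail p (ψ i β ∷ rest) o | OkP-singleton dq
  ... | o′ | _ , refl rewrite ∷-⊕ _ (OkT-∷-≽ o′ dq dr) = λ x<y →
    OT-sorted p (ψ i β) rest o
      (OkP-cancel-< (OT-head p (ψ i β ∷ rest) o) (OT-head (ψ i β) rest o′) dp dq x<y)

mainTheorem10 : (k : ℕ) → 2 ≤ k →
    ((m n : ℕ) (a b : Tm) → m < n → OkN k m a → OkN k n b → a <ₒ b)
    × ((α β a b : Tm) → OT₀ α → OT₀ β → α <ₒ β → OkT k α a → OkT k β b → a <ₒ b)
mainTheorem10 k _ =
  (λ m n a b → OkN-mono) ,
  (λ α β a b oα oβ → OkT-mono (proj₁ oα) (proj₁ oβ))
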